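{- For any graph $G$ with $n$ vertices, maximum degree $\Delta(G)$ and minimum degree $\delta(G)$, $TTr(G)\le \min\{\Delta(G)+1,\ n-\delta(G)\}$.
   Context: All graphs are finite and simple. For disjoint vertex sets $A,B$, $A$ dominates $B$ if every vertex of $B$ has a neighbour in $A$. A tournament transitive partition of order $k$ of $G=(V,E)$ is a partition $\{V_1,\dots,V_k\}$ of $V$ into nonempty sets such that for all $1\le i<j\le k$, $V_i$ dominates $V_j$ and $V_j$ does not dominate $V_i$. The tournament transitivity $TTr(G)$ is the maximum $k$ for which such a partition exists. -}

module Defs where

open import Data.Nat as ℕ using (ℕ; zero; suc; _⊔_; _⊓_)
open import Data.Fin as Fin using (Fin)
open import Data.Bool using (Bool; true; false; if_then_else_; T)
open import Data.List using (List; map; foldr; allFin)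
open import Data.Nat.ListAction using (sum)
open import Data.Product using (∃; _×_)
open import Relation.Binary.PropositionalEquality using (_≡_)
open import Relation.Nullary using (¬_)

record Graph (n : ℕ) : Set where
  field
    adj   : Fin n → Fin n → Bool
    sym   : ∀ u v → adj u v ≡ adj v u
    irrefl : ∀ v → adj v v ≡ false
open Graph public

deg : ∀ {n} → Graph n → Fin n → ℕ
deg {n} G v = sum (map (λ u → if adj G v u then 1 else 0) (allFin n))

maxDeg : ∀ {n} → Graph n → ℕ
maxDeg {n} G = foldr _⊔_ 0 (map (deg G) (allFin n))

minDeg : ∀ {n} → Graph n → ℕ
minDeg {zero}  G = 0
minDeg {suc n} G = foldr _⊓_ (deg G Fin.zero) (map (deg G) (allFin (suc n)))

-- A partition of the vertices into k nonempty classes V_0,…,V_{k-1},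
-- given by the class-assignment map `part`.
-- Class i dominates class j: every vertex of V_j has a neighbour in V_i.
Dominates : ∀ {n k} → Graph n → (Fin n → Fin k) → Fin k → Fin k → Set
Dominates G part i j =
  ∀ v → part v ≡ j → ∃ λ u → part u ≡ i × T (adj G u v)

record IsTTPartition {n : ℕ} (G : Graph n) (k : ℕ) (part : Fin n → Fin k) : Set where
  field
    nonempty : ∀ i → ∃ λ v → part v ≡ i
    forward  : ∀ i j → i Fin.< j → Dominates G part i j
    backward : ∀ i j → i Fin.< j → ¬ Dominates G part j i

-- TTr(G) ≤ m  means: every tournament transitive partition has order ≤ m.
TTr≤ : ∀ {n} → Graph n → ℕ → Set
TTr≤ G m = ∀ k (part : _ → Fin k) → IsTTPartition G k part → k ℕ.≤ m

{-# OPTIONS --safe #-}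
-- Let w be a vertex of the last class V_k. Every earlier class dominates V_k, so w has a
-- neighbour in each of V_1, …, V_{k-1}, whence k - 1 ≤ deg w ≤ Δ(G). No earlier class V_j
-- is dominated by V_k, so V_j contains a vertex with no neighbour in V_k; these k - 1
-- vertices, together with w itself, are k distinct non-neighbours of w, whence
-- k ≤ n - deg w ≤ n - δ(G).
module Submission where

open import Defs hiding (sym)
open import Data.Nat using (ℕ; zero; suc; _+_; _∸_; _⊓_; _⊔_; _≤_; z≤n; s≤s)
open import Data.Nat.Properties
  using (≤-trans; +-suc; m≤n+m; m+n∸m≡n; ∸-monoʳ-≤; ⊓-glb; m≤m⊔n; m≤n⊔m; m⊓n≤m; m⊓n≤n)
open import Data.Nat.ListAction using (sum)
open import Data.Fin as Fin using (Fin; fromℕ; punchIn; punchOut)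
open import Data.Fin.Properties
  using (_≟_; any?; ≤fromℕ; ≤∧≢⇒<; punchIn-injective; punchInᵢ≢i; punchOut-injective; punchIn-punchOut)
open import Data.Bool using (Bool; true; false; if_then_else_; T; T?; not)
open import Data.List using (List; map; foldr; allFin)
open import Data.List.Properties using (map-tabulate)
open import Data.List.Membership.Propositional using (_∈_)
open import Data.List.Membership.Propositional.Properties using (∈-map⁺; ∈-allFin)
open import Data.List.Relation.Unary.Any using (here; there)
open import Data.Product using (∃; _×_; _,_; proj₁; proj₂)
open import Function using (_∘_)
open import Function.Definitions using (Injective)
open import Relation.Binary.PropositionalEquality
  using (_≡_; _≢_; refl; sym; trans; cong; subst; module ≡-Reasoning)
open import Relation.Nullary using (¬_; Dec; yes; no; contradiction)
open import Relation.Nullary.Decidable using (_×-dec_; ¬?; decidable-stable)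

≤-foldr-⊔ : ∀ {x b} {xs : List ℕ} → x ∈ xs → x ≤ foldr _⊔_ b xs
≤-foldr-⊔ (here refl) = m≤m⊔n _ _
≤-foldr-⊔ (there x∈xs) = ≤-trans (≤-foldr-⊔ x∈xs) (m≤n⊔m _ _)

foldr-⊓-≤ : ∀ {x b} {xs : List ℕ} → x ∈ xs → foldr _⊓_ b xs ≤ x
foldr-⊓-≤ (here refl) = m⊓n≤m _ _
foldr-⊓-≤ (there x∈xs) = ≤-trans (m⊓n≤n _ _) (foldr-⊓-≤ x∈xs)

deg≤maxDeg : ∀ {n} (G : Graph n) v → deg G v ≤ maxDeg G
deg≤maxDeg G v = ≤-foldr-⊔ (∈-map⁺ (deg G) (∈-allFin v))

minDeg≤deg : ∀ {n} (G : Graph n) v → minDeg G ≤ deg G v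
minDeg≤deg {suc _} G v = foldr-⊓-≤ (∈-map⁺ (deg G) (∈-allFin v))

-- deg G v is definitionally count (adj G v).
count : ∀ {n} → (Fin n → Bool) → ℕ
count {n} P = sum (map (λ u → if P u then 1 else 0) (allFin n))

count-suc : ∀ {n} (P : Fin (suc n) → Bool) →
            count P ≡ (if P Fin.zero then 1 else 0) + count (P ∘ Fin.suc)
count-suc {n} P = cong (λ xs → (if P Fin.zero then 1 else 0) + sum xs)
  (trans (map-tabulate Fin.suc indicator) (sym (map-tabulate (λ u → u) (indicator ∘ Fin.suc))))
  where
  indicator : Fin (suc n) → ℕ
  indicator u = if P u then 1 else 0

count-suc-true : ∀ {n} (P : Fin (suc n) → Bool) → T (P Fin.zero) →
                 count P ≡ suc (count (P ∘ Fin.suc))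
count-suc-true P P0 with P Fin.zero | count-suc P
... | true | eq = eq

count-suc-≥ : ∀ {n} (P : Fin (suc n) → Bool) → count (P ∘ Fin.suc) ≤ count P
count-suc-≥ P = subst (count (P ∘ Fin.suc) ≤_) (sym (count-suc P)) (m≤n+m _ _)

count-complement : ∀ {n} (P : Fin n → Bool) → count P + count (not ∘ P) ≡ n
count-complement {zero} P = refl
count-complement {suc n} P
  rewrite count-suc P | count-suc (not ∘ P)
  with P Fin.zero | count-complement (P ∘ Fin.suc)
... | true  | ih = cong suc ih
... | false | ih = trans (+-suc _ _) (cong suc ih)

count-not : ∀ {n} (P : Fin n → Bool) → count (not ∘ P) ≡ n ∸ count P
count-not {n} P = begin
  count (not ∘ P)                     ≡⟨ sym (m+n∸m≡n (count P) _) ⟩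
  count P + count (not ∘ P) ∸ count P ≡⟨ cong (_∸ count P) (count-complement P) ⟩
  n ∸ count P                         ∎
  where open ≡-Reasoning

-- Both cases of the induction step delete Fin.zero from the codomain with punchOut.
mutual
  injective⇒≤count : ∀ {m n} (P : Fin n → Bool) (f : Fin m → Fin n) →
                     Injective _≡_ _≡_ f → (∀ i → T (P (f i))) → m ≤ count P
  injective⇒≤count {zero} P f inj Pf = z≤n
  injective⇒≤count {suc m} {zero} P f inj Pf with f Fin.zero
  ... | ()
  injective⇒≤count {suc m} {suc n} P f inj Pf with any? (λ i → f i ≟ Fin.zero)
  ... | yes (i , fi≡0) =
    subst (suc m ≤_) (sym (count-suc-true P (subst (T ∘ P) fi≡0 (Pf i))))
      (s≤s (avoiding-zero⇒≤count P (f ∘ punchIn i)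
              (punchIn-injective i _ _ ∘ inj)
              (λ j fj≡0 → punchInᵢ≢i i j (inj (trans fj≡0 (sym fi≡0))))
              (Pf ∘ punchIn i)))
  ... | no ∄i = ≤-trans (avoiding-zero⇒≤count P f inj (λ j fj≡0 → ∄i (j , fj≡0)) Pf) (count-suc-≥ P)

  avoiding-zero⇒≤count : ∀ {m n} (P : Fin (suc n) → Bool) (f : Fin m → Fin (suc n)) →
                         Injective _≡_ _≡_ f → (∀ i → f i ≢ Fin.zero) → (∀ i → T (P (f i))) →
                         m ≤ count (P ∘ Fin.suc)
  avoiding-zero⇒≤count P f inj f≢0 Pf =
    injective⇒≤count (P ∘ Fin.suc) (λ i → punchOut (f≢0 i ∘ sym))
      (λ {i} {j} → inj ∘ punchOut-injective (f≢0 i ∘ sym) (f≢0 j ∘ sym))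
      (λ i → subst (T ∘ P) (sym (punchIn-punchOut (f≢0 i ∘ sym))) (Pf i))

¬T⇒T-not : ∀ {b} → ¬ T b → T (not b)
¬T⇒T-not {true}  ¬t = ¬t _
¬T⇒T-not {false} _  = _

module _ {n k} (G : Graph n) (part : Fin n → Fin k) where

  classwise-injective : ∀ {m} {f : Fin m → Fin n} {c : Fin m → Fin k} →
                        (∀ i → part (f i) ≡ c i) → Injective _≡_ _≡_ c → Injective _≡_ _≡_ f
  classwise-injective f∈c c-inj {i} {j} fi≡fj =
    c-inj (trans (sym (f∈c i)) (trans (cong part fi≡fj) (f∈c j)))

  has-neighbour-in? : ∀ i v → Dec (∃ λ u → part u ≡ i × T (adj G u v))
  has-neighbour-in? i v = any? (λ u → (part u ≟ i) ×-dec T? (adj G u v))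

  undominated-vertex : ∀ i j → ¬ Dominates G part i j →
                       ∃ λ v → part v ≡ j × ∀ u → part u ≡ i → ¬ T (adj G u v)
  undominated-vertex i j ¬dom
    with any? (λ v → (part v ≟ j) ×-dec ¬? (has-neighbour-in? i v))
  ... | yes (v , v∈j , ¬nb) = v , v∈j , λ u u∈i uv → ¬nb (u , u∈i , uv)
  ... | no ∄v = contradiction
    (λ v v∈j → decidable-stable (has-neighbour-in? i v) (λ ¬nb → ∄v (v , v∈j , ¬nb))) ¬dom

module _ {n k} (G : Graph n) (part : Fin n → Fin (suc k)) (w : Fin n) where

  dominated-by-all⇒≤deg : (∀ j → j ≢ part w → Dominates G part j (part w)) → k ≤ deg G w
  dominated-by-all⇒≤deg dom =
    injective⇒≤count (adj G w) (proj₁ ∘ neighbour)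
      (classwise-injective G part (proj₁ ∘ proj₂ ∘ neighbour) (punchIn-injective (part w) _ _))
      (proj₂ ∘ proj₂ ∘ neighbour)
    where
    neighbour : ∀ i → ∃ λ u → part u ≡ punchIn (part w) i × T (adj G w u)
    neighbour i with dom (punchIn (part w) i) (punchInᵢ≢i (part w) i) w refl
    ... | u , u∈i , uw = u , u∈i , subst T (Graph.sym G u w) uw

  dominates-none⇒≤n∸deg : (∀ j → j ≢ part w → ¬ Dominates G part (part w) j) →
                            suc k ≤ n ∸ deg G w
  dominates-none⇒≤n∸deg ¬dom =
    subst (suc k ≤_) (count-not (adj G w))
      (injective⇒≤count (not ∘ adj G w) (proj₁ ∘ non-neighbour)
        (classwise-injective G part (proj₁ ∘ proj₂ ∘ non-neighbour) (λ eq → eq))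
        (¬T⇒T-not ∘ proj₂ ∘ proj₂ ∘ non-neighbour))
    where
    non-neighbour : ∀ j → ∃ λ v → part v ≡ j × ¬ T (adj G w v)
    non-neighbour j with j ≟ part w
    ... | yes refl = w , refl , subst T (irrefl G w)
    ... | no j≢pw with undominated-vertex G part (part w) j (¬dom j j≢pw)
    ...   | v , v∈j , isolated = v , v∈j , isolated w refl

proposition2 : ∀ {n : ℕ} (G : Graph n) → TTr≤ G (suc (maxDeg G) ⊓ (n ∸ minDeg G))
proposition2 G zero part isTT = z≤n
proposition2 {n} G (suc k) part isTT = ⊓-glb
  (s≤s (≤-trans (dominated-by-all⇒≤deg G part w (λ j j≢pw → forward j (part w) (before-last j j≢pw)))
                (deg≤maxDeg G w)))
  (≤-trans (dominates-none⇒≤n∸deg G part w (λ j j≢pw → backward j (part w) (before-last j j≢pw)))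
           (∸-monoʳ-≤ n (minDeg≤deg G w)))
  where
  open IsTTPartition isTT
  w : Fin n
  w = proj₁ (nonempty (fromℕ k))
  w∈last : part w ≡ fromℕ k
  w∈last = proj₂ (nonempty (fromℕ k))
  before-last : ∀ j → j ≢ part w → j Fin.< part w
  before-last j j≢pw = subst (j Fin.<_) (sym w∈last)
    (≤∧≢⇒< (≤fromℕ j) (λ j≡last → j≢pw (trans j≡last (sym w∈last))))
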